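{- Let $\Phi=(V,\mathscr{C})$ be a hypergraph with $V=[n]$, let $T\in\mathbb{N}$ and let $R_1,\dots,R_T\in\{0,1\}$. For $\sigma\in\Omega_\Phi$ define $X_{\sigma,t}:=F(\sigma;R_1,\dots,R_t)$ for $0\le t\le T$, and define $Y_0:=\{1\}^V$ (the all-ones coloring) and $Y_t:=Y_{t-1}^{v_t\gets R_t}$ for $1\le t\le T$. Then for all $\sigma\in\Omega_\Phi$ and all $0\le t\le T$, $X_{\sigma,t}\le Y_t$ coordinatewise.
   Context: $\Phi=(V,\mathscr{C})$ has vertex set $V=[n]$ and hyperedges $\mathscr{C}$ (nonempty subsets of $V$). A coloring $\sigma\in\{0,1\}^V$ is an independent set if every $C\in\mathscr{C}$ contains some $v$ with $\sigma(v)=0$; $\Omega_\Phi$ is the set of independent sets. $\sigma^{v\gets r}$ denotes $\sigma$ with the value at $v$ replaced by $r$. $f(\sigma;v,r):=\sigma^{v\gets r}$ if $\sigma^{v\gets r}\in\Omega_\Phi$, else $f(\sigma;v,r):=\sigma$. The scan sequence is $v_i:=(i\bmod n)+1$, and $F(\sigma;r_1,\dots,r_t):=f(f(\cdots f(\sigma;v_1,r_1)\cdots);v_t,r_t)$ (with $F(\sigma;)=\sigma$ for $t=0$). -}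

module Defs where

open import Data.Nat using (ℕ; zero; suc; NonZero)
open import Data.Nat.DivMod using (_%_; m%n<n)
open import Data.Fin using (Fin; fromℕ<; _≟_)
open import Data.Bool using (Bool; true; false; _≤_; if_then_else_)
open import Data.List using (List; [])
open import Data.List.Relation.Unary.Any using (Any; any?)
open import Data.List.Relation.Unary.All using (All; all?)
open import Relation.Binary.PropositionalEquality using (_≡_)
open import Relation.Nullary using (Dec; yes; no; ¬_)
open import Data.Bool.Properties using () renaming (_≟_ to _≟ᵇ_)
open import Data.Product using (_×_)

-- A coloring of V = [n] (represented as Fin n, 0-indexed).
Coloring : ℕ → Set
Coloring n = Fin n → Bool

record Hyperedge (n : ℕ) : Set where
  constructor hedge
  field
    verts    : List (Fin n)
    nonempty : ¬ (verts ≡ [])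
open Hyperedge public

Hypergraph : ℕ → Set
Hypergraph n = List (Hyperedge n)

IsIndep : ∀ {n} → Hypergraph n → Coloring n → Set
IsIndep Φ σ = All (λ C → Any (λ v → σ v ≡ false) (verts C)) Φ

isIndep? : ∀ {n} (Φ : Hypergraph n) (σ : Coloring n) → Dec (IsIndep Φ σ)
isIndep? Φ σ = all? (λ C → any? (λ v → σ v ≟ᵇ false) (verts C)) Φ

update : ∀ {n} → Coloring n → Fin n → Bool → Coloring n
update σ v r w with w ≟ v
... | yes _ = r
... | no  _ = σ w

f : ∀ {n} → Hypergraph n → Coloring n → Fin n → Bool → Coloring n
f Φ σ v r with isIndep? Φ (update σ v r)
... | yes _ = update σ v r
... | no  _ = σ

-- scan sequence v_i = (i mod n) + 1; 0-indexed this is the vertex i mod n.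
scan : (n : ℕ) .{{_ : NonZero n}} → ℕ → Fin n
scan n i = fromℕ< (m%n<n i n)

-- F(σ; R_1, ..., R_t), with R : ℕ → Bool giving R_i at index i (i ≥ 1).
F : ∀ {n} .{{_ : NonZero n}} → Hypergraph n → Coloring n → (ℕ → Bool) → ℕ → Coloring n
F {n} Φ σ R zero    = σ
F {n} Φ σ R (suc t) = f Φ (F Φ σ R t) (scan n (suc t)) (R (suc t))

ones : ∀ {n} → Coloring n
ones _ = true

Y : (n : ℕ) .{{_ : NonZero n}} → (ℕ → Bool) → ℕ → Coloring n
Y n R zero    = ones
Y n R (suc t) = update (Y n R t) (scan n (suc t)) (R (suc t))

_≤ᶜ_ : ∀ {n} → Coloring n → Coloring n → Set
σ ≤ᶜ τ = ∀ v → σ v ≤ τ v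

-- Setting a vertex to 0 never creates a monochromatic hyperedge, so a rejected move of the
-- chain X always proposes 1. Hence each step of X either performs the same update as Y, or
-- keeps X unchanged while Y sets that vertex to 1, the top value; both preserve X ≤ Y,
-- starting from Y₀ = 1^V.
module Submission where

open import Defs
open import Data.Nat using (ℕ; zero; suc; NonZero; _≤_)
open import Data.Bool using (Bool; true; false)
open import Data.Bool.Properties using (≤-refl; ≤-maximum)
open import Data.Fin using (_≟_)
open import Data.List.Relation.Unary.All as All using ()
open import Data.List.Relation.Unary.Any as Any using ()
open import Relation.Binary.PropositionalEquality using (_≡_; refl)
open import Relation.Nullary using (yes; no; contradiction)

update-false-preserves-≡false : ∀ {n} (σ : Coloring n) v w → σ w ≡ false → update σ v false w ≡ false
update-false-preserves-≡false σ v w σw≡false with w ≟ v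
... | yes _ = refl
... | no  _ = σw≡false

update-false-preserves-IsIndep : ∀ {n} (Φ : Hypergraph n) σ v → IsIndep Φ σ → IsIndep Φ (update σ v false)
update-false-preserves-IsIndep Φ σ v = All.map (Any.map (update-false-preserves-≡false σ v _))

f-preserves-IsIndep : ∀ {n} (Φ : Hypergraph n) σ v r → IsIndep Φ σ → IsIndep Φ (f Φ σ v r)
f-preserves-IsIndep Φ σ v r σ-indep with isIndep? Φ (update σ v r)
... | yes updated-indep = updated-indep
... | no  _             = σ-indep

F-preserves-IsIndep : ∀ {n} .{{_ : NonZero n}} (Φ : Hypergraph n) σ R t → IsIndep Φ σ → IsIndep Φ (F Φ σ R t)
F-preserves-IsIndep Φ σ R zero    σ-indep = σ-indep
F-preserves-IsIndep Φ σ R (suc t) σ-indep = f-preserves-IsIndep Φ _ _ _ (F-preserves-IsIndep Φ σ R t σ-indep)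

≤ᶜ-ones : ∀ {n} (σ : Coloring n) → σ ≤ᶜ ones
≤ᶜ-ones σ w = ≤-maximum (σ w)

update-mono : ∀ {n} {σ τ : Coloring n} v r → σ ≤ᶜ τ → update σ v r ≤ᶜ update τ v r
update-mono v r σ≤τ w with w ≟ v
... | yes _ = ≤-refl
... | no  _ = σ≤τ w

≤ᶜ-update-true : ∀ {n} {σ τ : Coloring n} v → σ ≤ᶜ τ → σ ≤ᶜ update τ v true
≤ᶜ-update-true {σ = σ} v σ≤τ w with w ≟ v
... | yes _ = ≤-maximum (σ w)
... | no  _ = σ≤τ w

f≤ᶜupdate : ∀ {n} (Φ : Hypergraph n) {σ τ} v r → IsIndep Φ σ → σ ≤ᶜ τ → f Φ σ v r ≤ᶜ update τ v r
f≤ᶜupdate Φ {σ} v r σ-indep σ≤τ with isIndep? Φ (update σ v r)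
f≤ᶜupdate Φ v r     σ-indep σ≤τ | yes _       = update-mono v r σ≤τ
f≤ᶜupdate Φ v true  σ-indep σ≤τ | no  _       = ≤ᶜ-update-true v σ≤τ
f≤ᶜupdate Φ v false σ-indep σ≤τ | no  ¬indep = contradiction (update-false-preserves-IsIndep Φ _ v σ-indep) ¬indep

F≤ᶜY : (n : ℕ) .{{_ : NonZero n}} (Φ : Hypergraph n) (R : ℕ → Bool)
    → (σ : Coloring n) → IsIndep Φ σ → (t : ℕ) → F Φ σ R t ≤ᶜ Y n R t
F≤ᶜY n Φ R σ σ-indep zero    = ≤ᶜ-ones σ
F≤ᶜY n Φ R σ σ-indep (suc t) =
  f≤ᶜupdate Φ _ _ (F-preserves-IsIndep Φ σ R t σ-indep) (F≤ᶜY n Φ R σ σ-indep t)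

proposition3p3 : (n : ℕ) .{{_ : NonZero n}} (Φ : Hypergraph n) (T : ℕ) (R : ℕ → Bool)
    → (σ : Coloring n) → IsIndep Φ σ → (t : ℕ) → t ≤ T
    → F Φ σ R t ≤ᶜ Y n R t
proposition3p3 n Φ T R σ σ-indep t _ = F≤ᶜY n Φ R σ σ-indep t
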